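{- If a $v_3$ configuration has a proper $n_3$ subconfiguration, then $v\ge 14$.
   Context: A $w_3$ configuration is a set system consisting of $w$ lines, each a 3-subset of the point set, such that any two points lie in at most one common line and every point lies in exactly three lines (it then has exactly $w$ points). An $n_3$ subconfiguration of a $v_3$ configuration is a subset of its lines which, together with the union of these lines as point set, is an $n_3$ configuration; it is proper if $n<v$. -}

module Defs where

open import Data.Nat using (ℕ)
open import Data.Fin using (Fin)
open import Data.Fin.Subset using (Subset; _∈_; _∩_; ∣_∣; ⋃)
open import Data.Vec using (tabulate; lookup)
open import Data.List using (List; map; filter)
open import Data.Fin.Subset.Properties using (_∈?_)
open import Data.List using (allFin)
open import Relation.Binary.PropositionalEquality using (_≡_; _≢_)

-- Points are Fin v; lines are indexed by Fin v (a v_3 configuration has v lines).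
-- linesThrough line p : the set of line indices i with p ∈ line i.
linesThrough : {v : ℕ} → (Fin v → Subset v) → Fin v → Subset v
linesThrough line p = tabulate (λ i → lookup (line i) p)

record Config (v : ℕ) : Set where
  field
    line      : Fin v → Subset v
    lineSize  : ∀ i → ∣ line i ∣ ≡ 3
    linear    : ∀ i j p q → p ≢ q → p ∈ line i → q ∈ line i →
                p ∈ line j → q ∈ line j → i ≡ j
    regular   : ∀ p → ∣ linesThrough line p ∣ ≡ 3

open Config public

pointsOf : {v : ℕ} → Config v → Subset v → Subset v
pointsOf C S = ⋃ (map (line C) (filter (λ i → i ∈? S) (allFin _)))

-- S (a subset of the lines of C), with the union of its lines as point set,
-- is an n_3 configuration: n lines, n points, every point of the union lies in
-- exactly three lines of S.  (Lines are 3-subsets and any two points share at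
-- most one line automatically, being inherited from C.)
IsSubconfig : {v : ℕ} → Config v → Subset v → ℕ → Set
IsSubconfig C S n =
  (∣ S ∣ ≡ n) × (∣ pointsOf C S ∣ ≡ n) ×
  (∀ p → p ∈ pointsOf C S → ∣ S ∩ linesThrough (line C) p ∣ ≡ 3)
  where open import Data.Product using (_×_)

-- Call a point set closed if every line meeting it lies inside it.  The
-- points of a subconfiguration form a closed set: each of them lies on three
-- lines of the subconfiguration, hence on no other line.  The complement of a
-- closed set is closed as well, since a line meeting both would have to lie
-- inside the closed set.  A nonempty closed set contains a point p together
-- with its three lines, which pairwise meet only in p, so it has at least
-- 1 + 3 · 2 = 7 points.  A proper subconfiguration splits the points into two
-- nonempty closed sets, whence v ≥ 7 + 7.
module Submission where

open import Defs
open import Data.Nat using (ℕ; _<_; _≤_; suc; _+_; _∸_; z≤n; s≤s)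
open import Data.Nat.Properties
  using (module ≤-Reasoning; ≤-trans; ≤-<-trans; <-irrefl; <⇒≱; n≤1+n; +-suc; +-monoʳ-≤; +-mono-≤; m+[n∸m]≡n; <⇒≤; m<n⇒0<n∸m)
open import Data.Fin using (Fin)
open import Data.Fin.Properties using (any?)
open import Data.Fin.Subset
  using (Subset; _∈_; _∉_; _∩_; _∪_; ∁; _-_; _⊆_; ⁅_⁆; ⊥; ∣_∣; ⋃; Nonempty; inside; outside)
open import Data.Fin.Subset.Properties
  using ( _∈?_; ∣⊥∣≡0; ∣⁅x⁆∣≡1; x∈⁅x⁆; x∈p∪q⁺; x∈p∩q⁻
        ; p⊆q⇒∣p∣≤∣q∣; x∈p⇒∣p-x∣<∣p∣; x∈p∧x≢y⇒x∈p-y; ∣∁p∣≡n∸∣p∣; x∈∁p⇒x∉p; x∉p⇒x∈∁p)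
open import Data.Vec using ([]; _∷_; lookup)
open import Data.Vec.Properties using (lookup∘tabulate; []=⇒lookup; lookup⇒[]=)
open import Data.List using (List; []; _∷_; length)
import Data.List.Membership.Propositional as List
open import Data.List.Membership.Propositional.Properties using (∈-filter⁺; ∈-map⁺; ∈-allFin)
open import Data.List.Relation.Unary.All as All using (All; []; _∷_)
open import Data.List.Relation.Unary.Any using (here; there)
open import Data.List.Relation.Unary.AllPairs using ([]; _∷_)
open import Data.List.Relation.Unary.Unique.Propositional using (Unique)
open import Data.Product using (∃; _×_; _,_; proj₁; proj₂)
open import Data.Sum using (inj₁; inj₂)
open import Relation.Nullary using (yes; no; ¬?; contradiction)
open import Relation.Nullary.Decidable using (_×-dec_; decidable-stable)
open import Relation.Binary.PropositionalEquality using (_≡_; _≢_; refl; sym; trans; cong; cong₂; subst; subst₂)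

private
  variable
    n : ℕ
    p q : Subset n

∣p∪q∣≤∣p∣+∣q∣ : ∀ (p q : Subset n) → ∣ p ∪ q ∣ ≤ ∣ p ∣ + ∣ q ∣
∣p∪q∣≤∣p∣+∣q∣ []            []            = z≤n
∣p∪q∣≤∣p∣+∣q∣ (outside ∷ p) (outside ∷ q) = ∣p∪q∣≤∣p∣+∣q∣ p q
∣p∪q∣≤∣p∣+∣q∣ (inside  ∷ p) (outside ∷ q) = s≤s (∣p∪q∣≤∣p∣+∣q∣ p q)
∣p∪q∣≤∣p∣+∣q∣ (outside ∷ p) (inside  ∷ q) =
  subst (suc ∣ p ∪ q ∣ ≤_) (sym (+-suc ∣ p ∣ ∣ q ∣)) (s≤s (∣p∪q∣≤∣p∣+∣q∣ p q))
∣p∪q∣≤∣p∣+∣q∣ (inside  ∷ p) (inside  ∷ q) =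
  s≤s (≤-trans (∣p∪q∣≤∣p∣+∣q∣ p q) (+-monoʳ-≤ ∣ p ∣ (n≤1+n ∣ q ∣)))

∣q∣<∣p∣⇒∃∈p∉q : ∣ q ∣ < ∣ p ∣ → ∃ λ x → x ∈ p × x ∉ q
∣q∣<∣p∣⇒∃∈p∉q {q = q} {p = p} ∣q∣<∣p∣ with any? (λ x → x ∈? p ×-dec ¬? (x ∈? q))
... | yes found = found
... | no none   = contradiction (p⊆q⇒∣p∣≤∣q∣ p⊆q) (<⇒≱ ∣q∣<∣p∣)
  where
  p⊆q : p ⊆ q
  p⊆q {x} x∈p = decidable-stable (x ∈? q) (λ x∉q → none (x , x∈p , x∉q))

0<∣p∣⇒nonempty : ∀ {n} {p : Subset n} → 0 < ∣ p ∣ → Nonempty p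
0<∣p∣⇒nonempty {n} {p} 0<∣p∣ with ∣q∣<∣p∣⇒∃∈p∉q {q = ⊥} (subst (_< ∣ p ∣) (sym (∣⊥∣≡0 n)) 0<∣p∣)
... | x , x∈p , _ = x , x∈p

∣p∩q∣≡∣q∣⇒q⊆p : ∣ p ∩ q ∣ ≡ ∣ q ∣ → q ⊆ p
∣p∩q∣≡∣q∣⇒q⊆p {p = p} {q = q} ∣p∩q∣≡∣q∣ {x} x∈q = decidable-stable (x ∈? p) λ x∉p →
  <-irrefl ∣p∩q∣≡∣q∣ (∣p∩q∣<∣q∣ x∉p)
  where
  ∣p∩q∣<∣q∣ : x ∉ p → ∣ p ∩ q ∣ < ∣ q ∣
  ∣p∩q∣<∣q∣ x∉p = ≤-<-trans (p⊆q⇒∣p∣≤∣q∣ p∩q⊆q-x) (x∈p⇒∣p-x∣<∣p∣ x∈q)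
    where
    p∩q⊆q-x : p ∩ q ⊆ q - x
    p∩q⊆q-x {y} y∈p∩q with x∈p∩q⁻ p q y∈p∩q
    ... | y∈p , y∈q = x∈p∧x≢y⇒x∈p-y y∈q λ { refl → x∉p y∈p }

Unique⇒length≤∣p∣ : ∀ {xs : List (Fin n)} → Unique xs → All (_∈ p) xs → length xs ≤ ∣ p ∣
Unique⇒length≤∣p∣ []                    []            = z≤n
Unique⇒length≤∣p∣ (x≢xs ∷ unique-xs) (x∈p ∷ xs⊆p) =
  ≤-trans (s≤s (Unique⇒length≤∣p∣ unique-xs xs⊆p-x)) (x∈p⇒∣p-x∣<∣p∣ x∈p)
  where
  xs⊆p-x = All.zipWith (λ (x≢y , y∈p) → x∈p∧x≢y⇒x∈p-y y∈p λ y≡x → x≢y (sym y≡x)) (x≢xs , xs⊆p)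

∣⁅x⁆∪⁅y⁆∣≤2 : ∀ (x y : Fin n) → ∣ ⁅ x ⁆ ∪ ⁅ y ⁆ ∣ ≤ 2
∣⁅x⁆∪⁅y⁆∣≤2 x y = begin
  ∣ ⁅ x ⁆ ∪ ⁅ y ⁆ ∣     ≤⟨ ∣p∪q∣≤∣p∣+∣q∣ ⁅ x ⁆ ⁅ y ⁆ ⟩
  ∣ ⁅ x ⁆ ∣ + ∣ ⁅ y ⁆ ∣ ≡⟨ cong₂ _+_ (∣⁅x⁆∣≡1 x) (∣⁅x⁆∣≡1 y) ⟩
  2                     ∎
  where open ≤-Reasoning

∉⁅x⁆⇒≢ : ∀ {x y : Fin n} → y ∉ ⁅ x ⁆ → x ≢ y
∉⁅x⁆⇒≢ {x = x} y∉⁅x⁆ refl = y∉⁅x⁆ (x∈⁅x⁆ x)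

record TwoOthers (s : Subset n) (x : Fin n) : Set where
  field
    a b : Fin n
    a∈s : a ∈ s
    b∈s : b ∈ s
    x≢a : x ≢ a
    x≢b : x ≢ b
    a≢b : a ≢ b

-- Opaque: unfolding the chosen points makes unification in seven-collinear explode.
opaque
  twoOthers : ∀ (s : Subset n) → ∣ s ∣ ≡ 3 → (x : Fin n) → TwoOthers s x
  twoOthers s ∣s∣≡3 x
    with ∣q∣<∣p∣⇒∃∈p∉q {q = ⁅ x ⁆} (subst₂ _<_ (sym (∣⁅x⁆∣≡1 x)) (sym ∣s∣≡3) (s≤s (s≤s z≤n)))
  ... | a , a∈s , a∉⁅x⁆
    with ∣q∣<∣p∣⇒∃∈p∉q {q = ⁅ x ⁆ ∪ ⁅ a ⁆} (subst (_ <_) (sym ∣s∣≡3) (s≤s (∣⁅x⁆∪⁅y⁆∣≤2 x a)))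
  ... | b , b∈s , b∉⁅x⁆∪⁅a⁆ = record
    { a = a ; b = b ; a∈s = a∈s ; b∈s = b∈s
    ; x≢a = ∉⁅x⁆⇒≢ a∉⁅x⁆
    ; x≢b = ∉⁅x⁆⇒≢ (λ b∈⁅x⁆ → b∉⁅x⁆∪⁅a⁆ (x∈p∪q⁺ (inj₁ b∈⁅x⁆)))
    ; a≢b = ∉⁅x⁆⇒≢ (λ b∈⁅a⁆ → b∉⁅x⁆∪⁅a⁆ (x∈p∪q⁺ (inj₂ b∈⁅a⁆)))
    }

x∈p∈ps⇒x∈⋃ps : ∀ {x : Fin n} {ps : List (Subset n)} → x ∈ p → p List.∈ ps → x ∈ ⋃ ps
x∈p∈ps⇒x∈⋃ps x∈p (here refl)    = x∈p∪q⁺ (inj₁ x∈p)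
x∈p∈ps⇒x∈⋃ps x∈p (there p∈ps) = x∈p∪q⁺ (inj₂ (x∈p∈ps⇒x∈⋃ps x∈p p∈ps))

module _ {v : ℕ} (C : Config v) where

  ∈-linesThrough⁺ : ∀ {i x} → x ∈ line C i → i ∈ linesThrough (line C) x
  ∈-linesThrough⁺ {i} {x} x∈i =
    lookup⇒[]= i _ (trans (lookup∘tabulate (λ j → lookup (line C j) x) i) ([]=⇒lookup x∈i))

  ∈-linesThrough⁻ : ∀ {i x} → i ∈ linesThrough (line C) x → x ∈ line C i
  ∈-linesThrough⁻ {i} {x} i∈ =
    lookup⇒[]= x _ (trans (sym (lookup∘tabulate (λ j → lookup (line C j) x) i)) ([]=⇒lookup i∈))

  ∈-pointsOf : ∀ {S i x} → i ∈ S → x ∈ line C i → x ∈ pointsOf C S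
  ∈-pointsOf {S} {i} i∈S x∈i =
    x∈p∈ps⇒x∈⋃ps x∈i (∈-map⁺ (line C) (∈-filter⁺ (_∈? S) (∈-allFin i) i∈S))

  LineClosed : Subset v → Set
  LineClosed P = ∀ {i x y} → x ∈ line C i → y ∈ line C i → x ∈ P → y ∈ P

  ∁-lineClosed : ∀ {P} → LineClosed P → LineClosed (∁ P)
  ∁-lineClosed closed x∈i y∈i x∈∁P =
    x∉p⇒x∈∁p λ y∈P → x∈∁p⇒x∉p x∈∁P (closed y∈i x∈i y∈P)

  pointsOf-lineClosed : ∀ {S} →
    (∀ x → x ∈ pointsOf C S → ∣ S ∩ linesThrough (line C) x ∣ ≡ 3) →
    LineClosed (pointsOf C S)
  pointsOf-lineClosed through₃ {i} {x} x∈i y∈i x∈P = ∈-pointsOf i∈S y∈i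
    where
    i∈S = ∣p∩q∣≡∣q∣⇒q⊆p (trans (through₃ x x∈P) (sym (regular C x))) (∈-linesThrough⁺ x∈i)

  Collinear : Fin v → Fin v → Set
  Collinear p x = ∃ λ i → p ∈ line C i × x ∈ line C i

  ≢-on-distinct-lines : ∀ {p i j x y} → p ∈ line C i → p ∈ line C j → i ≢ j →
                        x ∈ line C i → p ≢ x → y ∈ line C j → x ≢ y
  ≢-on-distinct-lines {p} {i} {j} p∈i p∈j i≢j x∈i p≢x y∈j refl =
    i≢j (linear C i j p _ p≢x p∈i x∈i p∈j y∈j)

  seven-collinear : ∀ p → ∃ λ xs → length xs ≡ 7 × Unique xs × All (Collinear p) xs
  seven-collinear p =
    p ∷ a₁ ∷ b₁ ∷ a₂ ∷ b₂ ∷ a₃ ∷ b₃ ∷ [] , refl ,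
      ( (p≢a₁ ∷ p≢b₁ ∷ p≢a₂ ∷ p≢b₂ ∷ p≢a₃ ∷ p≢b₃ ∷ [])
      ∷ (a₁≢b₁ ∷ apart₁₂ a₁∈₁ p≢a₁ a₂∈₂ ∷ apart₁₂ a₁∈₁ p≢a₁ b₂∈₂
               ∷ apart₁₃ a₁∈₁ p≢a₁ a₃∈₃ ∷ apart₁₃ a₁∈₁ p≢a₁ b₃∈₃ ∷ [])
      ∷ (apart₁₂ b₁∈₁ p≢b₁ a₂∈₂ ∷ apart₁₂ b₁∈₁ p≢b₁ b₂∈₂
               ∷ apart₁₃ b₁∈₁ p≢b₁ a₃∈₃ ∷ apart₁₃ b₁∈₁ p≢b₁ b₃∈₃ ∷ [])
      ∷ (a₂≢b₂ ∷ apart₂₃ a₂∈₂ p≢a₂ a₃∈₃ ∷ apart₂₃ a₂∈₂ p≢a₂ b₃∈₃ ∷ [])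
      ∷ (apart₂₃ b₂∈₂ p≢b₂ a₃∈₃ ∷ apart₂₃ b₂∈₂ p≢b₂ b₃∈₃ ∷ [])
      ∷ (a₃≢b₃ ∷ [])
      ∷ [] ∷ []) ,
      ( (L₁ , p∈₁ , p∈₁) ∷ (L₁ , p∈₁ , a₁∈₁) ∷ (L₁ , p∈₁ , b₁∈₁) ∷ (L₂ , p∈₂ , a₂∈₂)
      ∷ (L₂ , p∈₂ , b₂∈₂) ∷ (L₃ , p∈₃ , a₃∈₃) ∷ (L₃ , p∈₃ , b₃∈₃) ∷ [])
    where
    first-line : Nonempty (linesThrough (line C) p)
    first-line = 0<∣p∣⇒nonempty (subst (0 <_) (sym (regular C p)) (s≤s z≤n))
    L₁ : Fin v
    L₁ = proj₁ first-line
    open TwoOthers (twoOthers (linesThrough (line C) p) (regular C p) L₁)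
      renaming (a to L₂; b to L₃; a∈s to L₂∋p; b∈s to L₃∋p; x≢a to L₁≢L₂; x≢b to L₁≢L₃; a≢b to L₂≢L₃)
    open TwoOthers (twoOthers (line C L₁) (lineSize C L₁) p)
      renaming (a to a₁; b to b₁; a∈s to a₁∈₁; b∈s to b₁∈₁; x≢a to p≢a₁; x≢b to p≢b₁; a≢b to a₁≢b₁)
    open TwoOthers (twoOthers (line C L₂) (lineSize C L₂) p)
      renaming (a to a₂; b to b₂; a∈s to a₂∈₂; b∈s to b₂∈₂; x≢a to p≢a₂; x≢b to p≢b₂; a≢b to a₂≢b₂)
    open TwoOthers (twoOthers (line C L₃) (lineSize C L₃) p)
      renaming (a to a₃; b to b₃; a∈s to a₃∈₃; b∈s to b₃∈₃; x≢a to p≢a₃; x≢b to p≢b₃; a≢b to a₃≢b₃)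

    p∈₁ : p ∈ line C L₁
    p∈₁ = ∈-linesThrough⁻ (proj₂ first-line)
    p∈₂ : p ∈ line C L₂
    p∈₂ = ∈-linesThrough⁻ L₂∋p
    p∈₃ : p ∈ line C L₃
    p∈₃ = ∈-linesThrough⁻ L₃∋p

    apart₁₂ : ∀ {x y} → x ∈ line C L₁ → p ≢ x → y ∈ line C L₂ → x ≢ y
    apart₁₂ = ≢-on-distinct-lines p∈₁ p∈₂ L₁≢L₂
    apart₁₃ : ∀ {x y} → x ∈ line C L₁ → p ≢ x → y ∈ line C L₃ → x ≢ y
    apart₁₃ = ≢-on-distinct-lines p∈₁ p∈₃ L₁≢L₃
    apart₂₃ : ∀ {x y} → x ∈ line C L₂ → p ≢ x → y ∈ line C L₃ → x ≢ y
    apart₂₃ = ≢-on-distinct-lines p∈₂ p∈₃ L₂≢L₃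

  nonempty-lineClosed⇒7≤∣P∣ : ∀ {P} → LineClosed P → Nonempty P → 7 ≤ ∣ P ∣
  nonempty-lineClosed⇒7≤∣P∣ {P} closed (p , p∈P) with seven-collinear p
  ... | xs , ∣xs∣≡7 , unique , collinear =
    subst (_≤ ∣ P ∣) ∣xs∣≡7
      (Unique⇒length≤∣p∣ unique (All.map on-P collinear))
    where
    on-P : ∀ {x} → Collinear p x → x ∈ P
    on-P (_ , p∈i , x∈i) = closed p∈i x∈i p∈P

corollary9 : (v : ℕ) (C : Config v) (S : Subset v) (n : ℕ) →
    IsSubconfig C S n → 0 < n → n < v → 14 ≤ v
corollary9 v C S n (_ , ∣P∣≡n , through₃) 0<n n<v =
  subst (14 ≤_) (m+[n∸m]≡n (<⇒≤ n<v)) (+-mono-≤ 7≤n 7≤v∸n)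
  where
  P : Subset v
  P = pointsOf C S

  P-closed : LineClosed C P
  P-closed = pointsOf-lineClosed C through₃

  ∣∁P∣≡v∸n : ∣ ∁ P ∣ ≡ v ∸ n
  ∣∁P∣≡v∸n = trans (∣∁p∣≡n∸∣p∣ P) (cong (v ∸_) ∣P∣≡n)

  7≤n : 7 ≤ n
  7≤n = subst (7 ≤_) ∣P∣≡n
    (nonempty-lineClosed⇒7≤∣P∣ C P-closed (0<∣p∣⇒nonempty (subst (0 <_) (sym ∣P∣≡n) 0<n)))

  7≤v∸n : 7 ≤ v ∸ n
  7≤v∸n = subst (7 ≤_) ∣∁P∣≡v∸n
    (nonempty-lineClosed⇒7≤∣P∣ C (∁-lineClosed C P-closed)
      (0<∣p∣⇒nonempty (subst (0 <_) (sym ∣∁P∣≡v∸n) (m<n⇒0<n∸m n<v))))
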